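{- Let $k\ge 1$ and $G\in\{CC_k,CC_k^-\}$. There exists a maximum cut $S$ of $G$ such that (i) $S$ has at most one block of each of the four types, and (ii) the (at most four) blocks of $S$, listed in increasing order of row index, follow the pattern $([S],[\bar S-S],[\bar S],[S-\bar S])$, where some of these blocks may be empty.
   Context: For an integer $k\ge 0$, $CC_k$ is the graph with vertex set $K\cup K'$, where $K=\{v_0,\dots,v_k\}$ and $K'=\{v'_0,\dots,v'_k\}$, $K$ and $K'$ are cliques, and $v_i$ is adjacent to $v'_j$ if and only if $j<i$; there are no other edges. $CC_k^-$ is $CC_k$ with the vertex $v'_k$ removed. For $G\in\{CC_k,CC_k^-\}$, row $i$ of $G$ is the pair $(v_i,v'_i)$ whenever both vertices belong to $G$ (rows $0,\dots,k$ for $CC_k$, rows $0,\dots,k-1$ for $CC_k^-$). A cut of $G$ is a subset $S\subseteq V(G)$, $\bar S=V(G)\setminus S$; its size is the number of edges with exactly one endpoint in $S$, and a maximum cut is one of maximum size. With respect to $S$, each row $i$ has a type: $S\times S$, $\bar S\times \bar S$, $S\times\bar S$ or $\bar S\times S$, the first coordinate indicating the side of $v_i$ and the second that of $v'_i$. A block is a maximal sequence of consecutive rows of the same type; its type is that of its rows. Blocks of type $S\times S$, $\bar S\times\bar S$, $S\times\bar S$, $\bar S\times S$ are denoted $[S]$, $[\bar S]$, $[S-\bar S]$, $[\bar S-S]$ respectively. -}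

module Defs where

open import Data.Bool using (Bool; true; false; not; _∧_; if_then_else_)
open import Data.Nat using (ℕ; zero; suc; _+_; _≤_; _<_; _<ᵇ_; _≡ᵇ_)
open import Data.Fin using (Fin; toℕ)
open import Data.Nat.ListAction using (sum)
open import Data.List using (List; allFin; map; concatMap; _∷_; [])
open import Data.Product using (_×_; _,_; Σ; ∃; ∃-syntax)
open import Relation.Binary.PropositionalEquality using (_≡_)

data Variant : Set where
  full minus : Variant

-- Vertices of CC_k: (i , false) is v_i, (i , true) is v'_i, for i ∈ {0..k}.
Vtx : ℕ → Set
Vtx k = Fin (suc k) × Bool

-- Membership of a vertex in G (CC_k^- lacks v'_k).
inG : ∀ {k} → Variant → Vtx k → Bool
inG full    _ = true
inG {k} minus (i , false) = true
inG {k} minus (i , true)  = not (toℕ i ≡ᵇ k)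

adj : ∀ {k} → Vtx k → Vtx k → Bool
adj (i , false) (j , false) = not (toℕ i ≡ᵇ toℕ j)
adj (i , true)  (j , true)  = not (toℕ i ≡ᵇ toℕ j)
adj (i , false) (j , true)  = toℕ j <ᵇ toℕ i
adj (i , true)  (j , false) = toℕ i <ᵇ toℕ j

allVtx : ∀ k → List (Vtx k)
allVtx k = concatMap (λ i → (i , false) ∷ (i , true) ∷ []) (allFin (suc k))

-- A cut: S u ≡ true means u ∈ S (values on vertices outside G are irrelevant).
Cut : ℕ → Set
Cut k = Vtx k → Bool

b2n : Bool → ℕ
b2n b = if b then 1 else 0

-- Size of the cut: number of edges of G with exactly one endpoint in S,
-- counted as ordered pairs (u , w) with u ∈ S, w ∉ S (each such edge once).
cutSize : ∀ {k} → Variant → Cut k → ℕ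
cutSize {k} g S =
  sum (concatMap (λ u → map (λ w →
         b2n (inG g u ∧ inG g w ∧ adj u w ∧ S u ∧ not (S w)))
       (allVtx k)) (allVtx k))

IsMaxCut : ∀ {k} → Variant → Cut k → Set
IsMaxCut {k} g S = ∀ (T : Cut k) → cutSize g T ≤ cutSize g S

numRows : Variant → ℕ → ℕ
numRows full  k = suc k
numRows minus k = k

-- Row i has type (S u_i , S u'_i) ∈ Bool × Bool; (true,true) = S×S, etc.
-- Block pattern ([S],[S̄-S],[S̄],[S-S̄]), blocks possibly empty: there are
-- thresholds a ≤ b ≤ c ≤ (#rows) such that rows [0,a) are S×S, rows [a,b)
-- are S̄×S, rows [b,c) are S̄×S̄ and rows [c,#rows) are S×S̄.
-- (This expresses both (i) at most one block of each type and (ii) the order.)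
BlockPattern : ∀ {k} → Variant → Cut k → Set
BlockPattern {k} g S =
  ∃[ a ] ∃[ b ] ∃[ c ] (a ≤ b × b ≤ c × c ≤ numRows g k ×
    (∀ (i : Fin (suc k)) → toℕ i < numRows g k →
        (toℕ i < a → S (i , false) ≡ true × S (i , true) ≡ true)
      × (a ≤ toℕ i → toℕ i < b → S (i , false) ≡ false × S (i , true) ≡ true)
      × (b ≤ toℕ i → toℕ i < c → S (i , false) ≡ false × S (i , true) ≡ false)
      × (c ≤ toℕ i → S (i , false) ≡ true × S (i , true) ≡ false)))

module Submission where

-- Row i of a cut has one of four types rA = S×S, rB = S̄×S, rC = S̄×S̄,
-- rD = S×S̄.  The cut size is a sum over pairs of rows i < j of a number
-- depending only on the two types (and on which v' vertices exist), so for the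
-- complete rows it depends on the order of the types.  For given row counts
-- N = (a, b, c, d):
--   * Φ(N) puts every pair of types in its better order; any arrangement
--     falls short of Φ(N) by at least the defect min(a,c)·min(b,d);
--   * the block pattern realises Ψ(N) = Φ(N) - a·d exactly.
-- Exchanging b ↔ d and/or a ↔ c (the latter is complementation of S) turns
-- Φ(N) - defect into Ψ of the rearranged counts, so every cut is dominated by
-- a block-pattern cut with the same number of rows.  There are finitely many
-- block-pattern cuts; one of largest size is therefore a maximum cut.

open import Defs
open import Data.Bool using (Bool; true; false; not; _∧_; _xor_)
open import Data.Bool.Properties using (not-involutive)
open import Data.Nat using (ℕ; zero; suc; _+_; _*_; _∸_; _≤_; _<_; _⊓_; z≤n; s≤s; _≤?_)
open import Data.Nat.Properties
open import Data.Nat.ListAction using (sum)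
open import Data.Nat.ListAction.Properties using (sum-++)
open import Data.Nat.Tactic.RingSolver using (solve-∀)
open import Data.Fin using (Fin; toℕ) renaming (zero to fz; suc to fs)
open import Data.List using (List; []; _∷_; _++_; map; concatMap; tabulate)
open import Data.Product using (_×_; _,_; proj₁; proj₂; Σ)
open import Data.Sum using (_⊎_; inj₁; inj₂; [_,_]′)
open import Data.Unit using (⊤; tt)
open import Data.Empty using (⊥-elim)
open import Relation.Nullary using (Dec; yes; no)
open import Relation.Binary.PropositionalEquality
open import Function using (case_of_)

sumL : {A : Set} → (A → ℕ) → List A → ℕ
sumL f [] = 0
sumL f (x ∷ xs) = f x + sumL f xs

sumF : (n : ℕ) → (Fin n → ℕ) → ℕ
sumF zero f = 0
sumF (suc n) f = f fz + sumF n (λ i → f (fs i))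

sumV : (n : ℕ) → (Fin n → Bool → ℕ) → ℕ
sumV n f = sumF n (λ i → f i false + f i true)

sumL-cong : {A : Set} {f g : A → ℕ} (xs : List A) → (∀ x → f x ≡ g x) → sumL f xs ≡ sumL g xs
sumL-cong [] eq = refl
sumL-cong (x ∷ xs) eq = cong₂ _+_ (eq x) (sumL-cong xs eq)

sumL-++ : {A : Set} (f : A → ℕ) (xs ys : List A) → sumL f (xs ++ ys) ≡ sumL f xs + sumL f ys
sumL-++ f [] ys = refl
sumL-++ f (x ∷ xs) ys = trans (cong (f x +_) (sumL-++ f xs ys)) (sym (+-assoc (f x) (sumL f xs) (sumL f ys)))

sumL-map : {A B : Set} (f : B → ℕ) (g : A → B) (xs : List A) → sumL f (map g xs) ≡ sumL (λ x → f (g x)) xs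
sumL-map f g [] = refl
sumL-map f g (x ∷ xs) = cong (f (g x) +_) (sumL-map f g xs)

sum-map : {A : Set} (f : A → ℕ) (xs : List A) → sum (map f xs) ≡ sumL f xs
sum-map f [] = refl
sum-map f (x ∷ xs) = cong (f x +_) (sum-map f xs)

sum-concatMap : {A : Set} (F : A → List ℕ) (xs : List A) → sum (concatMap F xs) ≡ sumL (λ x → sum (F x)) xs
sum-concatMap F [] = refl
sum-concatMap F (x ∷ xs) = trans (sum-++ (F x) (concatMap F xs)) (cong (sum (F x) +_) (sum-concatMap F xs))

sumF-cong : ∀ n {f g : Fin n → ℕ} → (∀ i → f i ≡ g i) → sumF n f ≡ sumF n g
sumF-cong zero eq = refl
sumF-cong (suc n) eq = cong₂ _+_ (eq fz) (sumF-cong n (λ i → eq (fs i)))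

sumF-+ : ∀ n (f g : Fin n → ℕ) → sumF n (λ i → f i + g i) ≡ sumF n f + sumF n g
sumF-+ zero f g = refl
sumF-+ (suc n) f g =
  trans (cong (f fz + g fz +_) (sumF-+ n (λ i → f (fs i)) (λ i → g (fs i))))
        (interchange (f fz) (g fz) _ _)
  where
  interchange : ∀ a b c d → a + b + (c + d) ≡ a + c + (b + d)
  interchange = solve-∀

sumL-allVtx : ∀ k (f : Vtx k → ℕ) → sumL f (allVtx k) ≡ sumV (suc k) (λ i b → f (i , b))
sumL-allVtx k f = go (suc k) (λ i → i)
  where
  go : ∀ n (h : Fin n → Fin (suc k)) →
    sumL f (concatMap (λ i → (i , false) ∷ (i , true) ∷ []) (tabulate h)) ≡ sumV n (λ i b → f (h i , b))
  go zero h = refl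
  go (suc n) h = trans (cong (λ z → f (h fz , false) + (f (h fz , true) + z)) (go n (λ i → h (fs i))))
                       (sym (+-assoc (f (h fz , false)) (f (h fz , true)) _))

pairSum : ∀ n → (Fin n × Bool → Fin n × Bool → ℕ) → ℕ
pairSum n H = sumV n (λ i b → sumV n (λ j c → H (i , b) (j , c)))

pairSum-cong : ∀ n {H H' : Fin n × Bool → Fin n × Bool → ℕ} →
  (∀ u w → H u w ≡ H' u w) → pairSum n H ≡ pairSum n H'
pairSum-cong n eq = sumF-cong n (λ i → cong₂ _+_
  (sumF-cong n (λ j → cong₂ _+_ (eq _ _) (eq _ _)))
  (sumF-cong n (λ j → cong₂ _+_ (eq _ _) (eq _ _))))

module PeelFirst {n : ℕ} (H : Fin (suc n) × Bool → Fin (suc n) × Bool → ℕ) where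
  f0 t0 : Fin (suc n) × Bool
  f0 = (fz , false)
  t0 = (fz , true)

  inside0 : ℕ
  inside0 = (H f0 f0 + H f0 t0) + (H t0 f0 + H t0 t0)

  fromF0 fromT0 into0 joining0 : Fin n → ℕ
  fromF0 j = H f0 (fs j , false) + H f0 (fs j , true)
  fromT0 j = H t0 (fs j , false) + H t0 (fs j , true)
  into0 j = (H (fs j , false) f0 + H (fs j , false) t0) + (H (fs j , true) f0 + H (fs j , true) t0)
  joining0 j = (fromF0 j + fromT0 j) + into0 j

  avoiding0 : Fin n × Bool → Fin n × Bool → ℕ
  avoiding0 (i , b) (j , c) = H (fs i , b) (fs j , c)

  peel : pairSum (suc n) H ≡ inside0 + (sumF n joining0 + pairSum n avoiding0)
  peel = begin
      ((H f0 f0 + H f0 t0) + sumF n fromF0) + ((H t0 f0 + H t0 t0) + sumF n fromT0)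
        + sumF n (λ i → rowF i + rowT i)
    ≡⟨ cong (((H f0 f0 + H f0 t0) + sumF n fromF0) + ((H t0 f0 + H t0 t0) + sumF n fromT0) +_)
         (trans (sumF-cong n (λ i → regroup (H (fs i , false) f0) (H (fs i , false) t0)
                                            (H (fs i , true) f0) (H (fs i , true) t0) (restF i) (restT i)))
                (sumF-+ n into0 (λ i → restF i + restT i))) ⟩
      ((H f0 f0 + H f0 t0) + sumF n fromF0) + ((H t0 f0 + H t0 t0) + sumF n fromT0)
        + (sumF n into0 + pairSum n avoiding0)
    ≡⟨ collect (H f0 f0 + H f0 t0) (H t0 f0 + H t0 t0) (sumF n fromF0) (sumF n fromT0)
               (sumF n into0) (pairSum n avoiding0) ⟩
      inside0 + (((sumF n fromF0 + sumF n fromT0) + sumF n into0) + pairSum n avoiding0)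
    ≡⟨ cong (λ z → inside0 + (z + pairSum n avoiding0))
         (sym (trans (sumF-+ n (λ j → fromF0 j + fromT0 j) into0)
                     (cong (_+ sumF n into0) (sumF-+ n fromF0 fromT0)))) ⟩
      inside0 + (sumF n joining0 + pairSum n avoiding0) ∎
    where
    open ≡-Reasoning
    restF restT rowF rowT : Fin n → ℕ
    restF i = sumV n (λ j c → H (fs i , false) (fs j , c))
    restT i = sumV n (λ j c → H (fs i , true) (fs j , c))
    rowF i = (H (fs i , false) f0 + H (fs i , false) t0) + restF i
    rowT i = (H (fs i , true) f0 + H (fs i , true) t0) + restT i
    regroup : ∀ a1 a2 a3 a4 i1 i2 → ((a1 + a2) + i1) + ((a3 + a4) + i2) ≡ ((a1 + a2) + (a3 + a4)) + (i1 + i2)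
    regroup = solve-∀
    collect : ∀ s1 s2 p q r d → ((s1 + p) + (s2 + q)) + (r + d) ≡ (s1 + s2) + (((p + q) + r) + d)
    collect = solve-∀

leaving : ∀ {k} → Variant → Cut k → Vtx k → Vtx k → ℕ
leaving g S u w = b2n (inG g u ∧ inG g w ∧ adj u w ∧ S u ∧ not (S w))

cutSize-pairSum : ∀ g k (S : Cut k) → cutSize g S ≡ pairSum (suc k) (leaving g S)
cutSize-pairSum g k S = begin
    sum (concatMap (λ u → map (leaving g S u) (allVtx k)) (allVtx k))
  ≡⟨ sum-concatMap (λ u → map (leaving g S u) (allVtx k)) (allVtx k) ⟩
    sumL (λ u → sum (map (leaving g S u) (allVtx k))) (allVtx k)
  ≡⟨ sumL-cong (allVtx k) (λ u → trans (sum-map (leaving g S u) (allVtx k)) (sumL-allVtx k (leaving g S u))) ⟩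
    sumL (λ u → sumV (suc k) (λ j c → leaving g S u (j , c))) (allVtx k)
  ≡⟨ sumL-allVtx k (λ u → sumV (suc k) (λ j c → leaving g S u (j , c))) ⟩
    pairSum (suc k) (leaving g S) ∎
  where open ≡-Reasoning

-- The type of a row: (v_i ∈ S , v'_i ∈ S).
Row : Set
Row = Bool × Bool

-- A row of G with a flag recording whether v'_i is a vertex of G.
PRow : Set
PRow = Row × Bool

-- Cut edges between a row p and a later row q: the K-edge v_p v_q, the
-- K'-edge v'_p v'_q (if both exist) and the edge v_q v'_p (if v'_p exists);
-- v_p v'_q is not an edge, and a row has no internal edge.
between : PRow → PRow → ℕ
between ((sp , tp) , ep) ((sq , tq) , eq) =
  b2n (sp xor sq) + (b2n (ep ∧ eq ∧ (tp xor tq)) + b2n (ep ∧ (sq xor tp)))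

rowsValue : List PRow → ℕ
rowsValue [] = 0
rowsValue (x ∷ xs) = sumL (between x) xs + rowsValue xs

-- The eight ordered vertex pairs joining row 0 to a later row, evaluated
-- by an exhaustive truth table (pw says whether the later v' exists).
out : Bool → Bool → Bool → Bool → Bool → ℕ
out a b c d x = b2n (a ∧ b ∧ c ∧ d ∧ not x)

joiningRows : ∀ pw x y u v →
  ((out true true true x u + out true pw false x v) + (out true true true y u + out true pw true y v))
  + ((out true true true u x + out true true true u y) + (out pw true false v x + out pw true true v y))
  ≡ between ((x , y) , true) ((u , v) , pw)
joiningRows true  true  true  true  true  = refl
joiningRows true  true  true  true  false = refl
joiningRows true  true  true  false true  = refl
joiningRows true  true  true  false false = refl
joiningRows true  true  false true  true  = refl
joiningRows true  true  false true  false = refl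
joiningRows true  true  false false true  = refl
joiningRows true  true  false false false = refl
joiningRows true  false true  true  true  = refl
joiningRows true  false true  true  false = refl
joiningRows true  false true  false true  = refl
joiningRows true  false true  false false = refl
joiningRows true  false false true  true  = refl
joiningRows true  false false true  false = refl
joiningRows true  false false false true  = refl
joiningRows true  false false false false = refl
joiningRows false true  true  true  true  = refl
joiningRows false true  true  true  false = refl
joiningRows false true  true  false true  = refl
joiningRows false true  true  false false = refl
joiningRows false true  false true  true  = refl
joiningRows false true  false true  false = refl
joiningRows false true  false false true  = refl
joiningRows false true  false false false = refl
joiningRows false false true  true  true  = refl
joiningRows false false true  true  false = refl
joiningRows false false true  false true  = refl
joiningRows false false true  false false = refl
joiningRows false false false true  true  = refl
joiningRows false false false true  false = refl
joiningRows false false false false true  = refl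
joiningRows false false false false false = refl

shift : ∀ {k} → Cut (suc k) → Cut k
shift S (i , b) = S (fs i , b)

rowAt : ∀ {k} → Variant → Cut k → Fin (suc k) → PRow
rowAt g S j = ((S (j , false) , S (j , true)) , inG g (j , true))

-- The type of row i, for i ≤ k (the value for larger i is irrelevant).
rowType : ∀ {k} → Cut k → ℕ → Row
rowType {k} S zero = (S (fz , false) , S (fz , true))
rowType {zero} S (suc i) = (false , false)
rowType {suc k} S (suc i) = rowType (shift S) i

tab : ℕ → (ℕ → Row) → List Row
tab zero f = []
tab (suc n) f = f 0 ∷ tab n (λ i → f (suc i))

completeRows : List Row → List PRow
completeRows = map (λ r → (r , true))

-- The incomplete last row (v_k without v'_k), present only in CC_k^-.
lastRow : Variant → Row → List PRow
lastRow full r = []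
lastRow minus r = (r , false) ∷ []

rowsValue-lastRow : ∀ g r → rowsValue (lastRow g r) ≡ 0
rowsValue-lastRow full r = refl
rowsValue-lastRow minus r = refl

rowsOf : Variant → ∀ k → Cut k → List PRow
rowsOf g k S = completeRows (tab (numRows g k) (rowType S)) ++ lastRow g (rowType S (numRows g k))

sumRows : ∀ g k (T : Cut k) p → sumF (suc k) (λ j → between p (rowAt g T j)) ≡ sumL (between p) (rowsOf g k T)
sumRows full zero T p = refl
sumRows minus zero T p = refl
sumRows full (suc k) T p = cong (between p (rowAt full T fz) +_) (sumRows full k (shift T) p)
sumRows minus (suc k) T p = cong (between p (rowAt minus T fz) +_) (sumRows minus k (shift T) p)

cutSize-rows : ∀ g k (S : Cut k) → cutSize g S ≡ rowsValue (rowsOf g k S)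
cutSize-rows full zero S = refl
cutSize-rows minus zero S = refl
cutSize-rows g (suc k) S = begin
    cutSize g S
  ≡⟨ cutSize-pairSum g (suc k) S ⟩
    pairSum (suc (suc k)) (leaving g S)
  ≡⟨ peel ⟩
    inside0 + (sumF (suc k) joining0 + pairSum (suc k) avoiding0)
  ≡⟨ cong₂ _+_ (inside0≡0 g)
       (cong₂ _+_ (trans (sumF-cong (suc k) (joining0≡ g)) (sumRows g k (shift S) row0))
                  (trans (pairSum-cong (suc k) (avoiding0≡ g))
                         (trans (sym (cutSize-pairSum g k (shift S))) (cutSize-rows g k (shift S))))) ⟩
    rowsValue (row0 ∷ rowsOf g k (shift S))
  ≡⟨ cong rowsValue (sym (rowsOf-suc g)) ⟩
    rowsValue (rowsOf g (suc k) S) ∎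
  where
  open ≡-Reasoning
  open PeelFirst (leaving g S)
  row0 : PRow
  row0 = (rowType S 0 , true)
  rowsOf-suc : ∀ g → rowsOf g (suc k) S ≡ row0 ∷ rowsOf g k (shift S)
  rowsOf-suc full = refl
  rowsOf-suc minus = refl
  inside0≡0 : ∀ g → PeelFirst.inside0 (leaving g S) ≡ 0
  inside0≡0 full = refl
  inside0≡0 minus = refl
  joining0≡ : ∀ g j → PeelFirst.joining0 (leaving g S) j ≡ between row0 (rowAt g (shift S) j)
  joining0≡ full j = joiningRows true (S (fz , false)) (S (fz , true)) (S (fs j , false)) (S (fs j , true))
  joining0≡ minus j = joiningRows (inG minus (j , true)) (S (fz , false)) (S (fz , true)) (S (fs j , false)) (S (fs j , true))
  avoiding0≡ : ∀ g u w → PeelFirst.avoiding0 (leaving g S) u w ≡ leaving g (shift S) u w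
  avoiding0≡ full (i , false) (j , false) = refl
  avoiding0≡ full (i , false) (j , true) = refl
  avoiding0≡ full (i , true) (j , false) = refl
  avoiding0≡ full (i , true) (j , true) = refl
  avoiding0≡ minus (i , false) (j , false) = refl
  avoiding0≡ minus (i , false) (j , true) = refl
  avoiding0≡ minus (i , true) (j , false) = refl
  avoiding0≡ minus (i , true) (j , true) = refl

-- The four row types, named after the blocks of the theorem:
-- rA = S×S ([S]), rB = S̄×S ([S̄-S]), rC = S̄×S̄ ([S̄]), rD = S×S̄ ([S-S̄]).
rA rB rC rD : Row
rA = (true , true)
rB = (false , true)
rC = (false , false)
rD = (true , false)

record Counts : Set where
  constructor counts
  field
    nA nB nC nD : ℕ
open Counts

bump : Row → Counts → Counts
bump (true , true) (counts a b c d) = counts (suc a) b c d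
bump (false , true) (counts a b c d) = counts a (suc b) c d
bump (false , false) (counts a b c d) = counts a b (suc c) d
bump (true , false) (counts a b c d) = counts a b c (suc d)

countRows : List Row → Counts
countRows [] = counts 0 0 0 0
countRows (r ∷ τ) = bump r (countRows τ)

total : Counts → ℕ
total N = nA N + nB N + nC N + nD N

weigh : (Row → ℕ) → Counts → ℕ
weigh w N = w rA * nA N + w rB * nB N + w rC * nC N + w rD * nD N

weigh-bump : ∀ w p N → weigh w (bump p N) ≡ weigh w N + w p
weigh-bump w (true , true) (counts a b c d) = lemma (w rA) (w rB) (w rC) (w rD) a b c d
  where lemma : ∀ x y z u a b c d → x * suc a + y * b + z * c + u * d ≡ x * a + y * b + z * c + u * d + x
        lemma = solve-∀
weigh-bump w (false , true) (counts a b c d) = lemma (w rA) (w rB) (w rC) (w rD) a b c d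
  where lemma : ∀ x y z u a b c d → x * a + y * suc b + z * c + u * d ≡ x * a + y * b + z * c + u * d + y
        lemma = solve-∀
weigh-bump w (false , false) (counts a b c d) = lemma (w rA) (w rB) (w rC) (w rD) a b c d
  where lemma : ∀ x y z u a b c d → x * a + y * b + z * suc c + u * d ≡ x * a + y * b + z * c + u * d + z
        lemma = solve-∀
weigh-bump w (true , false) (counts a b c d) = lemma (w rA) (w rB) (w rC) (w rD) a b c d
  where lemma : ∀ x y z u a b c d → x * a + y * b + z * c + u * suc d ≡ x * a + y * b + z * c + u * d + u
        lemma = solve-∀

weigh-empty : ∀ w → weigh w (counts 0 0 0 0) ≡ 0
weigh-empty w = lemma (w rA) (w rB) (w rC) (w rD)
  where lemma : ∀ x y z u → x * 0 + y * 0 + z * 0 + u * 0 ≡ 0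
        lemma = solve-∀

sumL-weigh : ∀ w τ → sumL w τ ≡ weigh w (countRows τ)
sumL-weigh w [] = sym (weigh-empty w)
sumL-weigh w (p ∷ τ) = trans (+-comm (w p) (sumL w τ))
  (trans (cong (_+ w p) (sumL-weigh w τ)) (sym (weigh-bump w p (countRows τ))))

total-tab : ∀ n f → total (countRows (tab n f)) ≡ n
total-tab n f = begin
    total N
  ≡⟨ ones (nA N) (nB N) (nC N) (nD N) ⟩
    weigh (λ _ → 1) N
  ≡⟨ sym (sumL-weigh (λ _ → 1) (tab n f)) ⟩
    sumL (λ _ → 1) (tab n f)
  ≡⟨ length-tab n f ⟩
    n ∎
  where
  open ≡-Reasoning
  N = countRows (tab n f)
  ones : ∀ a b c d → a + b + c + d ≡ 1 * a + 1 * b + 1 * c + 1 * d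
  ones = solve-∀
  length-tab : ∀ n f → sumL (λ _ → 1) (tab n f) ≡ n
  length-tab zero f = refl
  length-tab (suc n) f = cong suc (length-tab n (λ i → f (suc i)))

-- The weights between (p , true) (q , true), p above q, are
--   rA: rA 0, rB 2, rC 3, rD 1     rB: rA 1, rB 1, rC 2, rD 2
--   rC: rA 3, rB 1, rC 0, rD 2     rD: rA 2, rB 2, rC 1, rD 1.
gain : Row → Counts → ℕ
gain p N = weigh (λ q → between (p , true) (q , true)) N

gainAbove : List PRow → Counts → ℕ
gainAbove X N = weigh (λ r → sumL (between (r , true)) X) N

gain-rows : ∀ p τ X → sumL (between (p , true)) (completeRows τ ++ X) ≡ gain p (countRows τ) + sumL (between (p , true)) X
gain-rows p τ X = trans (sumL-++ (between (p , true)) (completeRows τ) X)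
  (cong (_+ sumL (between (p , true)) X)
        (trans (sumL-map (between (p , true)) (λ r → (r , true)) τ) (sumL-weigh (λ q → between (p , true) (q , true)) τ)))

gainAbove-bump : ∀ X p N → gainAbove X (bump p N) ≡ gainAbove X N + sumL (between (p , true)) X
gainAbove-bump X = weigh-bump (λ r → sumL (between (r , true)) X)

pairs : ℕ → ℕ
pairs zero = 0
pairs (suc n) = n + pairs n

-- For every two types, the larger of the two weights times the number of
-- such pairs of rows: an upper bound for complete rows in any order.
Φ : Counts → ℕ
Φ (counts a b c d) = 2 * a * b + 3 * a * c + 2 * a * d + pairs b + 2 * b * c + 2 * b * d + 2 * c * d + pairs d

-- What a new top row of type p loses against Φ: its weight towards the
-- one type that it would rather have above it (rD, rA, rB, rC respectively).
slack : Row → Counts → ℕ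
slack (true , true) N = nD N
slack (false , true) N = nA N
slack (false , false) N = nB N
slack (true , false) N = nC N

Φ-bump : ∀ p N → Φ (bump p N) ≡ Φ N + gain p N + slack p N
Φ-bump (true , true) (counts a b c d) = lemma (pairs b) (pairs d) a b c d
  where lemma : ∀ t u a b c d → 2 * suc a * b + 3 * suc a * c + 2 * suc a * d + t + 2 * b * c + 2 * b * d + 2 * c * d + u
          ≡ 2 * a * b + 3 * a * c + 2 * a * d + t + 2 * b * c + 2 * b * d + 2 * c * d + u + (0 * a + 2 * b + 3 * c + 1 * d) + d
        lemma = solve-∀
Φ-bump (false , true) (counts a b c d) = lemma (pairs b) (pairs d) a b c d
  where lemma : ∀ t u a b c d → 2 * a * suc b + 3 * a * c + 2 * a * d + (b + t) + 2 * suc b * c + 2 * suc b * d + 2 * c * d + u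
          ≡ 2 * a * b + 3 * a * c + 2 * a * d + t + 2 * b * c + 2 * b * d + 2 * c * d + u + (1 * a + 1 * b + 2 * c + 2 * d) + a
        lemma = solve-∀
Φ-bump (false , false) (counts a b c d) = lemma (pairs b) (pairs d) a b c d
  where lemma : ∀ t u a b c d → 2 * a * b + 3 * a * suc c + 2 * a * d + t + 2 * b * suc c + 2 * b * d + 2 * suc c * d + u
          ≡ 2 * a * b + 3 * a * c + 2 * a * d + t + 2 * b * c + 2 * b * d + 2 * c * d + u + (3 * a + 1 * b + 0 * c + 2 * d) + b
        lemma = solve-∀
Φ-bump (true , false) (counts a b c d) = lemma (pairs b) (pairs d) a b c d
  where lemma : ∀ t u a b c d → 2 * a * b + 3 * a * c + 2 * a * suc d + t + 2 * b * c + 2 * b * suc d + 2 * c * suc d + (d + u)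
          ≡ 2 * a * b + 3 * a * c + 2 * a * d + t + 2 * b * c + 2 * b * d + 2 * c * d + u + (2 * a + 2 * b + 1 * c + 1 * d) + c
        lemma = solve-∀

-- A lower bound for the total loss against Φ of any arrangement.
defect : Counts → ℕ
defect (counts a b c d) = (a ⊓ c) * (b ⊓ d)

*-grow-left : ∀ {x y} z {w} → x ≤ suc y → z ≤ w → x * z ≤ y * z + w
*-grow-left {x} {y} z {w} x≤ z≤w = begin
    x * z      ≤⟨ *-monoˡ-≤ z x≤ ⟩
    z + y * z  ≡⟨ +-comm z (y * z) ⟩
    y * z + z  ≤⟨ +-monoʳ-≤ (y * z) z≤w ⟩
    y * z + w  ∎
  where open ≤-Reasoning

*-grow-right : ∀ z {x y w} → x ≤ suc y → z ≤ w → z * x ≤ z * y + w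
*-grow-right z {x} {y} {w} x≤ z≤w =
  subst₂ (λ u v → u ≤ v + w) (*-comm x z) (*-comm y z) (*-grow-left z x≤ z≤w)

⊓-sucˡ : ∀ a c → suc a ⊓ c ≤ suc (a ⊓ c)
⊓-sucˡ a c = ⊓-mono-≤ (≤-refl {suc a}) (n≤1+n c)

⊓-sucʳ : ∀ a c → a ⊓ suc c ≤ suc (a ⊓ c)
⊓-sucʳ a c = ⊓-mono-≤ (n≤1+n a) (≤-refl {suc c})

defect-bump : ∀ p N → defect (bump p N) ≤ defect N + slack p N
defect-bump (true , true) (counts a b c d) = *-grow-left (b ⊓ d) (⊓-sucˡ a c) (m⊓n≤n b d)
defect-bump (false , true) (counts a b c d) = *-grow-right (a ⊓ c) (⊓-sucˡ b d) (m⊓n≤m a c)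
defect-bump (false , false) (counts a b c d) = *-grow-left (b ⊓ d) (⊓-sucʳ a c) (m⊓n≤m b d)
defect-bump (true , false) (counts a b c d) = *-grow-right (a ⊓ c) (⊓-sucʳ b d) (m⊓n≤n a c)

rows-bound : ∀ X τ → rowsValue (completeRows τ ++ X) + defect (countRows τ)
                     ≤ Φ (countRows τ) + gainAbove X (countRows τ) + rowsValue X
rows-bound X [] = ≤-reflexive (trans (+-identityʳ (rowsValue X))
  (cong (_+ rowsValue X) (sym (weigh-empty (λ r → sumL (between (r , true)) X)))))
rows-bound X (p ∷ τ) = begin
    sumL (between (p , true)) (completeRows τ ++ X) + V + defect (bump p N)
  ≡⟨ cong (λ z → z + V + defect (bump p N)) (gain-rows p τ X) ⟩
    (l + ε) + V + defect (bump p N)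
  ≤⟨ +-monoʳ-≤ ((l + ε) + V) (defect-bump p N) ⟩
    (l + ε) + V + (defect N + s)
  ≡⟨ regroup l ε V (defect N) s ⟩
    (l + ε + s) + (V + defect N)
  ≤⟨ +-monoʳ-≤ (l + ε + s) (rows-bound X τ) ⟩
    (l + ε + s) + (Φ N + gainAbove X N + rowsValue X)
  ≡⟨ collect l ε s (Φ N) (gainAbove X N) (rowsValue X) ⟩
    (Φ N + l + s) + (gainAbove X N + ε) + rowsValue X
  ≡⟨ sym (cong₂ (λ u v → u + v + rowsValue X) (Φ-bump p N) (gainAbove-bump X p N)) ⟩
    Φ (bump p N) + gainAbove X (bump p N) + rowsValue X ∎
  where
  open ≤-Reasoning
  N = countRows τ
  V = rowsValue (completeRows τ ++ X)
  l = gain p N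
  ε = sumL (between (p , true)) X
  s = slack p N
  regroup : ∀ l ε V m s → (l + ε) + V + (m + s) ≡ (l + ε + s) + (V + m)
  regroup = solve-∀
  collect : ∀ l ε s φ L W → (l + ε + s) + (φ + L + W) ≡ (φ + l + s) + (L + ε) + W
  collect = solve-∀

-- The value of complete rows in the block order [S], [S̄-S], [S̄], [S-S̄]:
-- every pair of types is in its better order except rA above rD.
Ψ : Counts → ℕ
Ψ (counts a b c d) = 2 * a * b + 3 * a * c + a * d + pairs b + 2 * b * c + 2 * b * d + 2 * c * d + pairs d

Exact : List PRow → List Row → Counts → Set
Exact X τ N = countRows τ ≡ N × rowsValue (completeRows τ ++ X) ≡ Ψ N + gainAbove X N + rowsValue X

Exact-cons : ∀ X p τ N → Ψ (bump p N) ≡ Ψ N + gain p N → Exact X τ N → Exact X (p ∷ τ) (bump p N)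
Exact-cons X p τ N Ψ-grows (refl , value) = refl , (begin
    sumL (between (p , true)) (completeRows τ ++ X) + rowsValue (completeRows τ ++ X)
  ≡⟨ cong₂ _+_ (gain-rows p τ X) value ⟩
    gain p N + ε + (Ψ N + gainAbove X N + rowsValue X)
  ≡⟨ regroup (gain p N) ε (Ψ N) (gainAbove X N) (rowsValue X) ⟩
    (Ψ N + gain p N) + (gainAbove X N + ε) + rowsValue X
  ≡⟨ cong₂ (λ u v → u + v + rowsValue X) (sym Ψ-grows) (sym (gainAbove-bump X p N)) ⟩
    Ψ (bump p N) + gainAbove X (bump p N) + rowsValue X ∎)
  where
  open ≡-Reasoning
  ε = sumL (between (p , true)) X
  regroup : ∀ l ε ψ L W → l + ε + (ψ + L + W) ≡ (ψ + l) + (L + ε) + W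
  regroup = solve-∀

-- Row i of the block pattern with a, b, c, d rows of types rA, rB, rC, rD,
-- followed by an incomplete row with v on side s.
patRow : ℕ → ℕ → ℕ → ℕ → Bool → ℕ → Row
patRow (suc a) b c d s zero = rA
patRow (suc a) b c d s (suc i) = patRow a b c d s i
patRow zero (suc b) c d s zero = rB
patRow zero (suc b) c d s (suc i) = patRow zero b c d s i
patRow zero zero (suc c) d s zero = rC
patRow zero zero (suc c) d s (suc i) = patRow zero zero c d s i
patRow zero zero zero (suc d) s zero = rD
patRow zero zero zero (suc d) s (suc i) = patRow zero zero zero d s i
patRow zero zero zero zero s i = (s , false)

-- The block pattern realises Ψ: each new top row sees, below it, only
-- types it prefers to have below.
patRow-exact : ∀ X a b c d s → Exact X (tab (a + b + c + d) (patRow a b c d s)) (counts a b c d)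
patRow-exact X (suc a) b c d s =
  Exact-cons X rA (tab (a + b + c + d) (patRow a b c d s)) (counts a b c d) (grows a b c d (pairs b) (pairs d)) (patRow-exact X a b c d s)
  where grows : ∀ a b c d t u → 2 * suc a * b + 3 * suc a * c + suc a * d + t + 2 * b * c + 2 * b * d + 2 * c * d + u
                  ≡ 2 * a * b + 3 * a * c + a * d + t + 2 * b * c + 2 * b * d + 2 * c * d + u + (0 * a + 2 * b + 3 * c + 1 * d)
        grows = solve-∀
patRow-exact X zero (suc b) c d s =
  Exact-cons X rB (tab (b + c + d) (patRow 0 b c d s)) (counts 0 b c d) (grows b c d (pairs b) (pairs d)) (patRow-exact X 0 b c d s)
  where grows : ∀ b c d t u → 2 * 0 * suc b + 3 * 0 * c + 0 * d + (b + t) + 2 * suc b * c + 2 * suc b * d + 2 * c * d + u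
                  ≡ 2 * 0 * b + 3 * 0 * c + 0 * d + t + 2 * b * c + 2 * b * d + 2 * c * d + u + (1 * 0 + 1 * b + 2 * c + 2 * d)
        grows = solve-∀
patRow-exact X zero zero (suc c) d s =
  Exact-cons X rC (tab (c + d) (patRow 0 0 c d s)) (counts 0 0 c d) (grows c d (pairs d)) (patRow-exact X 0 0 c d s)
  where grows : ∀ c d u → 2 * 0 * 0 + 3 * 0 * suc c + 0 * d + 0 + 2 * 0 * suc c + 2 * 0 * d + 2 * suc c * d + u
                  ≡ 2 * 0 * 0 + 3 * 0 * c + 0 * d + 0 + 2 * 0 * c + 2 * 0 * d + 2 * c * d + u + (3 * 0 + 1 * 0 + 0 * c + 2 * d)
        grows = solve-∀
patRow-exact X zero zero zero (suc d) s =
  Exact-cons X rD (tab d (patRow 0 0 0 d s)) (counts 0 0 0 d) (grows d (pairs d)) (patRow-exact X 0 0 0 d s)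
  where grows : ∀ d u → 2 * 0 * 0 + 3 * 0 * 0 + 0 * suc d + 0 + 2 * 0 * 0 + 2 * 0 * suc d + 2 * 0 * suc d + (d + u)
                  ≡ 2 * 0 * 0 + 3 * 0 * 0 + 0 * d + 0 + 2 * 0 * 0 + 2 * 0 * d + 2 * 0 * d + u + (2 * 0 + 2 * 0 + 1 * 0 + 1 * d)
        grows = solve-∀
patRow-exact X zero zero zero zero s =
  refl , cong (_+ rowsValue X) (sym (weigh-empty (λ r → sumL (between (r , true)) X)))

patEnd : ∀ a b c d s → patRow a b c d s (a + b + c + d) ≡ (s , false)
patEnd (suc a) b c d s = patEnd a b c d s
patEnd zero (suc b) c d s = patEnd zero b c d s
patEnd zero zero (suc c) d s = patEnd zero zero c d s
patEnd zero zero zero (suc d) s = patEnd zero zero zero d s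
patEnd zero zero zero zero s = refl

cutOf : ∀ {k} → (ℕ → Row) → Cut k
cutOf f (i , false) = proj₁ (f (toℕ i))
cutOf f (i , true) = proj₂ (f (toℕ i))

patternCut : ∀ {k} → Counts → Bool → Cut k
patternCut N s = cutOf (patRow (nA N) (nB N) (nC N) (nD N) s)

Agrees : ∀ {k} → Cut k → (ℕ → Row) → Set
Agrees {k} S f = ∀ (i : Fin (suc k)) → S (i , false) ≡ proj₁ (f (toℕ i)) × S (i , true) ≡ proj₂ (f (toℕ i))

row0 : ∀ {k} (S : Cut k) f → Agrees S f → rowType S 0 ≡ f 0
row0 S f ag = cong₂ _,_ (proj₁ (ag fz)) (proj₂ (ag fz))

rowsOf-agree : ∀ g k (S : Cut k) f → Agrees S f →
  rowsOf g k S ≡ completeRows (tab (numRows g k) f) ++ lastRow g (f (numRows g k))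
rowsOf-agree full zero S f ag = cong (λ r → (r , true) ∷ []) (row0 S f ag)
rowsOf-agree minus zero S f ag = cong (λ r → (r , false) ∷ []) (row0 S f ag)
rowsOf-agree full (suc k) S f ag = cong₂ (λ r rs → (r , true) ∷ rs) (row0 S f ag)
  (rowsOf-agree full k (shift S) (λ i → f (suc i)) (λ i → ag (fs i)))
rowsOf-agree minus (suc k) S f ag = cong₂ (λ r rs → (r , true) ∷ rs) (row0 S f ag)
  (rowsOf-agree minus k (shift S) (λ i → f (suc i)) (λ i → ag (fs i)))

patternCut-value : ∀ g k N s → total N ≡ numRows g k →
  cutSize g (patternCut {k} N s) ≡ Ψ N + gainAbove (lastRow g (s , false)) N
patternCut-value g k (counts a b c d) s rows = begin
    cutSize g (cutOf f)
  ≡⟨ cutSize-rows g k (cutOf f) ⟩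
    rowsValue (rowsOf g k (cutOf f))
  ≡⟨ cong rowsValue (rowsOf-agree g k (cutOf f) f (λ i → refl , refl)) ⟩
    rowsValue (completeRows (tab (numRows g k) f) ++ lastRow g (f (numRows g k)))
  ≡⟨ cong (λ n → rowsValue (completeRows (tab n f) ++ lastRow g (f n))) (sym rows) ⟩
    rowsValue (completeRows (tab (a + b + c + d) f) ++ lastRow g (f (a + b + c + d)))
  ≡⟨ cong (λ r → rowsValue (completeRows (tab (a + b + c + d) f) ++ lastRow g r)) (patEnd a b c d s) ⟩
    rowsValue (completeRows (tab (a + b + c + d) f) ++ X)
  ≡⟨ proj₂ (patRow-exact X a b c d s) ⟩
    Ψ N + gainAbove X N + rowsValue X
  ≡⟨ trans (cong (Ψ N + gainAbove X N +_) (rowsValue-lastRow g (s , false))) (+-identityʳ _) ⟩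
    Ψ N + gainAbove X N ∎
  where
  open ≡-Reasoning
  f = patRow a b c d s
  N = counts a b c d
  X = lastRow g (s , false)

inA : ∀ a b c d s j → j < a → patRow a b c d s j ≡ rA
inA (suc a) b c d s zero _ = refl
inA (suc a) b c d s (suc j) (s≤s lt) = inA a b c d s j lt

inB : ∀ a b c d s j → a ≤ j → j < a + b → patRow a b c d s j ≡ rB
inB (suc a) b c d s (suc j) (s≤s le) (s≤s lt) = inB a b c d s j le lt
inB zero (suc b) c d s zero _ _ = refl
inB zero (suc b) c d s (suc j) _ (s≤s lt) = inB zero b c d s j z≤n lt

inC : ∀ a b c d s j → a + b ≤ j → j < a + b + c → patRow a b c d s j ≡ rC
inC (suc a) b c d s (suc j) (s≤s le) (s≤s lt) = inC a b c d s j le lt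
inC zero (suc b) c d s (suc j) (s≤s le) (s≤s lt) = inC zero b c d s j le lt
inC zero zero (suc c) d s zero _ _ = refl
inC zero zero (suc c) d s (suc j) _ (s≤s lt) = inC zero zero c d s j z≤n lt

inD : ∀ a b c d s j → a + b + c ≤ j → j < a + b + c + d → patRow a b c d s j ≡ rD
inD (suc a) b c d s (suc j) (s≤s le) (s≤s lt) = inD a b c d s j le lt
inD zero (suc b) c d s (suc j) (s≤s le) (s≤s lt) = inD zero b c d s j le lt
inD zero zero (suc c) d s (suc j) (s≤s le) (s≤s lt) = inD zero zero c d s j le lt
inD zero zero zero (suc d) s zero _ _ = refl
inD zero zero zero (suc d) s (suc j) _ (s≤s lt) = inD zero zero zero d s j z≤n lt

patternCut-blocks : ∀ g k N s → total N ≡ numRows g k → BlockPattern g (patternCut {k} N s)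
patternCut-blocks g k (counts a b c d) s rows =
  a , a + b , a + b + c , m≤m+n a b , m≤m+n (a + b) c , subst (a + b + c ≤_) rows (m≤m+n (a + b + c) d) ,
  λ i i<rows →
    (λ i<a → sides (inA a b c d s (toℕ i) i<a)) ,
    (λ a≤i i<b → sides (inB a b c d s (toℕ i) a≤i i<b)) ,
    (λ b≤i i<c → sides (inC a b c d s (toℕ i) b≤i i<c)) ,
    (λ c≤i → sides (inD a b c d s (toℕ i) c≤i (subst (toℕ i <_) (sym rows) i<rows)))
  where
  sides : ∀ {r r' : Row} → r ≡ r' → proj₁ r ≡ proj₁ r' × proj₂ r ≡ proj₂ r'
  sides eq = cong proj₁ eq , cong proj₂ eq

lin : ℕ → ℕ → ℕ → Counts → ℕ
lin x y z N = x * nA N + y * nB N + z * nC N + y * nD N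

cancel : ∀ {V m m' P R} → V + m ≤ P → m ≡ m' → P ≡ R + m' → V ≤ R
cancel {V} {m} {m'} {P} {R} h refl P≡ = +-cancelʳ-≤ m V R (subst (V + m ≤_) P≡ h)

-- The comparison at the heart of the proof: if V falls short of Φ(N) + lin
-- by the defect, then V is at most the value Ψ of a block pattern whose
-- counts rearrange N (exchanging rB ↔ rD and/or rA ↔ rC; the latter is the
-- complement of S and also exchanges the coefficients of rA and rC).
rearrange : ∀ x y z V N → V + defect N ≤ Φ N + lin x y z N →
  Σ Counts λ N' → total N' ≡ total N × (V ≤ Ψ N' + lin x y z N' ⊎ V ≤ Ψ N' + lin z y x N')
rearrange x y z V (counts a b c d) h with a ≤? c | b ≤? d
... | yes a≤c | yes b≤d = counts a d c b , perm a b c d , inj₁ (cancel h (cong₂ _*_ (m≤n⇒m⊓n≡m a≤c) (m≤n⇒m⊓n≡m b≤d))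
  (identity a b c d (pairs b) (pairs d) x y z))
  where
  perm : ∀ a b c d → a + d + c + b ≡ a + b + c + d
  perm = solve-∀
  identity : ∀ a b c d t u x y z → 2 * a * b + 3 * a * c + 2 * a * d + t + 2 * b * c + 2 * b * d + 2 * c * d + u + (x * a + y * b + z * c + y * d)
    ≡ (2 * a * d + 3 * a * c + a * b + u + 2 * d * c + 2 * d * b + 2 * c * b + t + (x * a + y * d + z * c + y * b)) + a * b
  identity = solve-∀
... | yes a≤c | no b≰d = counts a b c d , refl , inj₁ (cancel h (cong₂ _*_ (m≤n⇒m⊓n≡m a≤c) (m≥n⇒m⊓n≡n (≰⇒≥ b≰d)))
  (identity a b c d (pairs b) (pairs d) x y z))
  where
  identity : ∀ a b c d t u x y z → 2 * a * b + 3 * a * c + 2 * a * d + t + 2 * b * c + 2 * b * d + 2 * c * d + u + (x * a + y * b + z * c + y * d)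
    ≡ (2 * a * b + 3 * a * c + a * d + t + 2 * b * c + 2 * b * d + 2 * c * d + u + (x * a + y * b + z * c + y * d)) + a * d
  identity = solve-∀
... | no a≰c | yes b≤d = counts c d a b , perm a b c d , inj₂ (cancel h (cong₂ _*_ (m≥n⇒m⊓n≡n (≰⇒≥ a≰c)) (m≤n⇒m⊓n≡m b≤d))
  (identity a b c d (pairs b) (pairs d) x y z))
  where
  perm : ∀ a b c d → c + d + a + b ≡ a + b + c + d
  perm = solve-∀
  identity : ∀ a b c d t u x y z → 2 * a * b + 3 * a * c + 2 * a * d + t + 2 * b * c + 2 * b * d + 2 * c * d + u + (x * a + y * b + z * c + y * d)
    ≡ (2 * c * d + 3 * c * a + c * b + u + 2 * d * a + 2 * d * b + 2 * a * b + t + (z * c + y * d + x * a + y * b)) + c * b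
  identity = solve-∀
... | no a≰c | no b≰d = counts c b a d , perm a b c d , inj₂ (cancel h (cong₂ _*_ (m≥n⇒m⊓n≡n (≰⇒≥ a≰c)) (m≥n⇒m⊓n≡n (≰⇒≥ b≰d)))
  (identity a b c d (pairs b) (pairs d) x y z))
  where
  perm : ∀ a b c d → c + b + a + d ≡ a + b + c + d
  perm = solve-∀
  identity : ∀ a b c d t u x y z → 2 * a * b + 3 * a * c + 2 * a * d + t + 2 * b * c + 2 * b * d + 2 * c * d + u + (x * a + y * b + z * c + y * d)
    ≡ (2 * c * b + 3 * c * a + c * d + t + 2 * b * a + 2 * b * d + 2 * a * d + u + (z * c + y * b + x * a + y * d)) + c * d
  identity = solve-∀

-- Cut edges between a complete row of type rA and the last row of G when
-- v_k is on side s (none for CC_k, which has no incomplete last row);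
-- by complementation a row of type rC sees toLast g (not s), and the
-- mixed types rB, rD see toMixed g.
toLast : Variant → Bool → ℕ
toLast full s = 0
toLast minus true = 0
toLast minus false = 2

toMixed : Variant → ℕ
toMixed full = 0
toMixed minus = 1

gainAbove-lastRow : ∀ g s t N → gainAbove (lastRow g (s , t)) N ≡ lin (toLast g s) (toMixed g) (toLast g (not s)) N
gainAbove-lastRow full s t N = refl
gainAbove-lastRow minus true t N = refl
gainAbove-lastRow minus false t N = refl

-- Every cut is dominated by a pattern cut: bound its complete rows by
-- rows-bound, rearrange, and read the result as the value of a pattern
-- cut (for CC_k^- with v_k on the side of the original cut or the other).
dominated : ∀ g k (T : Cut k) →
  Σ Counts λ N → Σ Bool λ s → total N ≡ numRows g k × cutSize g T ≤ cutSize g (patternCut {k} N s)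
dominated g k T = N' , s , rows , ≤-trans (proj₂ side) (≤-reflexive (sym (patternCut-value g k N' s rows)))
  where
  τ = tab (numRows g k) (rowType T)
  r = rowType T (numRows g k)
  s₀ = proj₁ r
  V = cutSize g T
  N = countRows τ
  upper : V + defect N ≤ Φ N + lin (toLast g s₀) (toMixed g) (toLast g (not s₀)) N
  upper = subst₂ (λ v w → v + defect N ≤ w)
    (sym (cutSize-rows g k T))
    (trans (cong (Φ N + gainAbove (lastRow g r) N +_) (rowsValue-lastRow g r))
           (trans (+-identityʳ _) (cong (Φ N +_) (gainAbove-lastRow g s₀ (proj₂ r) N))))
    (rows-bound (lastRow g r) τ)
  found = rearrange (toLast g s₀) (toMixed g) (toLast g (not s₀)) V N upper
  N' = proj₁ found
  rows : total N' ≡ numRows g k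
  rows = trans (proj₁ (proj₂ found)) (total-tab (numRows g k) (rowType T))
  Bounded : Bool → Set
  Bounded s = V ≤ Ψ N' + gainAbove (lastRow g (s , false)) N'
  side : Σ Bool Bounded
  side = [ (λ le → s₀ , subst (λ L → V ≤ Ψ N' + L) (sym (gainAbove-lastRow g s₀ false N')) le)
         , (λ le → not s₀ , subst (λ L → V ≤ Ψ N' + L) complemented le) ]′ (proj₂ (proj₂ found))
    where
    complemented : lin (toLast g (not s₀)) (toMixed g) (toLast g s₀) N' ≡ gainAbove (lastRow g (not s₀ , false)) N'
    complemented = sym (trans (gainAbove-lastRow g (not s₀) false N')
                              (cong (λ t → lin (toLast g (not s₀)) (toMixed g) (toLast g t) N') (not-involutive s₀)))
  s = proj₁ side

Maximisable : (A : Set) → (A → Set) → Set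
Maximisable A P = (f : A → ℕ) → Σ A λ m → P m × (∀ x → P x → f x ≤ f m)

≤-suc-cases : ∀ {x N} → x ≤ suc N → x ≤ N ⊎ x ≡ suc N
≤-suc-cases x≤ = Data.Sum.map₁ ≤-pred (m≤n⇒m<n∨m≡n x≤)

maximisable-≤ : ∀ N → Maximisable ℕ (_≤ N)
maximisable-≤ zero f = 0 , z≤n , λ { .0 z≤n → ≤-refl }
maximisable-≤ (suc N) f = extend (f (suc N) ≤? f m)
  where
  found = maximisable-≤ N f
  m = proj₁ found
  below = proj₂ (proj₂ found)
  extend : Dec (f (suc N) ≤ f m) → Σ ℕ λ m' → m' ≤ suc N × (∀ x → x ≤ suc N → f x ≤ f m')
  extend (yes le) = m , m≤n⇒m≤1+n (proj₁ (proj₂ found)) ,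
    λ x x≤ → [ below x , (λ { refl → le }) ]′ (≤-suc-cases x≤)
  extend (no nle) = suc N , ≤-refl ,
    λ x x≤ → [ (λ x≤N → ≤-trans (below x x≤N) (≰⇒≥ nle)) , (λ { refl → ≤-refl }) ]′ (≤-suc-cases x≤)

maximisable-Bool : Maximisable Bool (λ _ → ⊤)
maximisable-Bool f with f false ≤? f true
... | yes le = true , tt , λ { true _ → ≤-refl ; false _ → le }
... | no nle = false , tt , λ { true _ → ≰⇒≥ nle ; false _ → ≤-refl }

maximisable-× : ∀ {A B P Q} → Maximisable A P → Maximisable B Q →
  Maximisable (A × B) (λ ab → P (proj₁ ab) × Q (proj₂ ab))
maximisable-× maxA maxB f =
  (a* , inner a*) , (proj₁ (proj₂ outer) , proj₁ (proj₂ (maxB (λ b → f (a* , b))))) ,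
  λ { (a , b) (Pa , Qb) → ≤-trans (proj₂ (proj₂ (maxB (λ b → f (a , b)))) b Qb) (proj₂ (proj₂ outer) a Pa) }
  where
  inner : _ → _
  inner a = proj₁ (maxB (λ b → f (a , b)))
  outer = maxA (λ a → f (a , inner a))
  a* = proj₁ outer

maximisable-onto : ∀ {A B P Q} (h : A → B) → (∀ a → P a → Q (h a)) → (∀ b → Q b → Σ A λ a → P a × h a ≡ b) →
  Maximisable A P → Maximisable B Q
maximisable-onto h into onto maxA f =
  h m , into m Pm , λ b Qb → subst (λ b' → f b' ≤ f (h m)) (proj₂ (proj₂ (onto b Qb)))
                               (best (proj₁ (onto b Qb)) (proj₁ (proj₂ (onto b Qb))))
  where
  found = maxA (λ a → f (h a))
  m = proj₁ found
  Pm = proj₁ (proj₂ found)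
  best = proj₂ (proj₂ found)

complete : ℕ → ℕ × ℕ × ℕ → Counts
complete n (a , b , c) with a + b + c ≤? n
... | yes _ = counts a b c (n ∸ (a + b + c))
... | no _ = counts 0 0 0 n

total-complete : ∀ n t → total (complete n t) ≡ n
total-complete n (a , b , c) with a + b + c ≤? n
... | yes le = m+[n∸m]≡n le
... | no _ = refl

complete-onto : ∀ n N → total N ≡ n → Σ (ℕ × ℕ × ℕ) λ t → (proj₁ t ≤ n × proj₁ (proj₂ t) ≤ n × proj₂ (proj₂ t) ≤ n) × complete n t ≡ N
complete-onto n (counts a b c d) refl =
  (a , b , c) , (a≤ , b≤ , c≤) , completed
  where
  abc≤ : a + b + c ≤ a + b + c + d
  abc≤ = m≤m+n (a + b + c) d
  a≤ = ≤-trans (≤-trans (m≤m+n a b) (m≤m+n (a + b) c)) abc≤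
  b≤ = ≤-trans (≤-trans (m≤n+m b a) (m≤m+n (a + b) c)) abc≤
  c≤ = ≤-trans (m≤n+m c (a + b)) abc≤
  completed : complete (a + b + c + d) (a , b , c) ≡ counts a b c d
  completed with a + b + c ≤? a + b + c + d
  ... | yes _ = cong (counts a b c) (m+n∸m≡n (a + b + c) d)
  ... | no abc≰ = ⊥-elim (abc≰ abc≤)

-- The candidates (row counts with n rows, side of v_k) form a maximisable set.
-- Opaque, so that the maximiser it returns is never unfolded when cut values
-- of it are compared.
opaque
  maximisable-candidates : ∀ n → Maximisable (Counts × Bool) (λ c → total (proj₁ c) ≡ n × ⊤)
  maximisable-candidates n = maximisable-× compositions maximisable-Bool
    where
    compositions : Maximisable Counts (λ N → total N ≡ n)
    compositions = maximisable-onto (complete n) (λ t _ → total-complete n t) (complete-onto n)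
      (maximisable-× (maximisable-≤ n) (maximisable-× (maximisable-≤ n) (maximisable-≤ n)))

lemma2 : (k : ℕ) → 1 ≤ k → (g : Variant) →
    Σ (Cut k) (λ S → IsMaxCut g S × BlockPattern g S)
lemma2 k _ g = patternCut N s , isMax , patternCut-blocks g k N s (proj₁ (proj₁ (proj₂ best)))
  where
  value : Counts × Bool → ℕ
  value c = cutSize g (patternCut {k} (proj₁ c) (proj₂ c))
  best : Σ (Counts × Bool) λ m → (total (proj₁ m) ≡ numRows g k × ⊤) × (∀ c → total (proj₁ c) ≡ numRows g k × ⊤ → value c ≤ value m)
  best = maximisable-candidates (numRows g k) value
  N : Counts
  N = proj₁ (proj₁ best)
  s : Bool
  s = proj₂ (proj₁ best)
  isMax : IsMaxCut g (patternCut N s)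
  isMax T = case dominated g k T of λ
    { (N' , s' , rows , T≤pattern) → ≤-trans T≤pattern (proj₂ (proj₂ best) (N' , s') (rows , tt)) }
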